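{- If $\Omega\vdash A_m$ is derivable in the ordered adjoint sequent calculus, then $\Gamma\vdash A_m\dashv\Omega$ is derivable in ordered adjoint natural deduction with explicit structural rules for every set $\Gamma$ of labeled hypotheses containing all labeled hypotheses of $\Omega$.
   Context: Modes and propositions. Fix a preorder $(\mathcal{M},\geq)$ of modes and, for each mode $m$, a set $\sigma(m)\subseteq\{\mathsf{W},\mathsf{C}^\leftarrow,\mathsf{C}^\rightarrow,\mathsf{M}^\leftarrow,\mathsf{M}^\rightarrow\}$, monotone: $k\geq m$ implies $\sigma(k)\supseteq\sigma(m)$. Propositions: $A_m ::= P_m \mid A_m \rightarrowtail B_m \mid A_m \twoheadrightarrow B_m \mid A_m \,\&\, B_m \mid {\uparrow}^m_l A_l\ (m\geq l) \mid A_m\bullet B_m \mid 1_m \mid A_m\oplus B_m \mid {\downarrow}^k_m A_k\ (k\geq m)$. An ordered context $\Omega$ is a finite sequence of labeled hypotheses $x{:}A_m$ (repetitions allowed, each variable always labeling the same proposition); $|\Omega|$ is its set of variables; $\Omega\geq m$ means every $y{:}B_k$ in $\Omega$ has $k\geq m$. Sequent calculus: sequents $\Omega\vdash C_r$ presupposing $\Omega\geq r$; new variables in premises are fresh. Rules (premises $\Rightarrow$ conclusion): (id) $\Rightarrow x{:}A_m\vdash A_m$; (cut) $\Omega_A\vdash A_m$, $\Omega_L(x{:}A_m)\Omega_R\vdash C_r$, $\Omega_A\geq m\geq r\Rightarrow\Omega_L\Omega_A\Omega_R\vdash C_r$; ($1R$) $\Rightarrow\cdot\vdash1_m$; ($1L$)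 $\Omega_L\Omega_R\vdash C_r\Rightarrow\Omega_L(x{:}1_m)\Omega_R\vdash C_r$; ($\bullet R$) $\Omega_1\vdash A_m,\Omega_2\vdash B_m\Rightarrow\Omega_1\Omega_2\vdash A_m\bullet B_m$; ($\bullet L$) $\Omega_L(x_1{:}A_m)(x_2{:}B_m)\Omega_R\vdash C_r\Rightarrow\Omega_L(x{:}A_m\bullet B_m)\Omega_R\vdash C_r$; ($\oplus R_i$) $\Omega\vdash A_m$ (resp. $B_m$) $\Rightarrow\Omega\vdash A_m\oplus B_m$; ($\oplus L$) $\Omega_L(y{:}A_m)\Omega_R\vdash C_r$, $\Omega_L(y{:}B_m)\Omega_R\vdash C_r\Rightarrow\Omega_L(x{:}A_m\oplus B_m)\Omega_R\vdash C_r$; (${\downarrow}R$) $\Omega\vdash A_k$, $\Omega\geq k\Rightarrow\Omega\vdash{\downarrow}^k_mA_k$; (${\downarrow}L$) $\Omega_L(y{:}A_k)\Omega_R\vdash C_r\Rightarrow\Omega_L(x{:}{\downarrow}^k_mA_k)\Omega_R\vdash C_r$; ($\twoheadrightarrow R$) $\Omega(x{:}A_m)\vdash B_m\Rightarrow\Omega\vdash A_m\twoheadrightarrow B_m$; ($\twoheadrightarrow L$) $\Omega_A\vdash A_m$, $\Omega_A\geq m$, $\Omega_L(y{:}B_m)\Omega_R\vdash C_r\Rightarrow\Omega_L(f{:}A_m\twoheadrightarrow B_m)\Omega_A\Omega_R\vdash C_r$; ($\rightarrowtail R$) $(x{:}A_m)\Omega\vdash B_m\Rightarrow\Omega\vdash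 A_m\rightarrowtail B_m$; ($\rightarrowtail L$) $\Omega_A\vdash A_m$, $\Omega_A\geq m$, $\Omega_L(y{:}B_m)\Omega_R\vdash C_r\Rightarrow\Omega_L\Omega_A(f{:}A_m\rightarrowtail B_m)\Omega_R\vdash C_r$; ($\&R$) $\Omega\vdash A_m,\Omega\vdash B_m\Rightarrow\Omega\vdash A_m\&B_m$; ($\&L_i$) $\Omega_L(y{:}A_m)\Omega_R\vdash C_r$ (resp. $B_m$) $\Rightarrow\Omega_L(x{:}A_m\&B_m)\Omega_R\vdash C_r$; (${\uparrow}R$) $\Omega\vdash A_l\Rightarrow\Omega\vdash{\uparrow}^m_lA_l$; (${\uparrow}L$) $\Omega_L(y{:}A_l)\Omega_R\vdash C_r$, $l\geq r\Rightarrow\Omega_L(x{:}{\uparrow}^m_lA_l)\Omega_R\vdash C_r$; structural rules ($\mathsf{M}^\leftarrow$) $\Omega_L\Omega_M(x{:}A_m)\Omega_R\vdash C_r\Rightarrow\Omega_L(x{:}A_m)\Omega_M\Omega_R\vdash C_r$ if $\mathsf{M}^\leftarrow\in\sigma(m)$; ($\mathsf{M}^\rightarrow$) $\Omega_L(x{:}A_m)\Omega_M\Omega_R\vdash C_r\Rightarrow\Omega_L\Omega_M(x{:}A_m)\Omega_R\vdash C_r$ if $\mathsf{M}^\rightarrow\in\sigma(m)$; ($\mathsf{C}^\leftarrow$) $\Omega_L(x{:}A_m)\Omega_M(x{:}A_m)\Omega_R\vdash C_r\Rightarrow\Omega_L(x{:}A_m)\Omega_M\Omega_R\vdash C_r$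 if $\mathsf{C}^\leftarrow\in\sigma(m)$; ($\mathsf{C}^\rightarrow$) same premise $\Rightarrow\Omega_L\Omega_M(x{:}A_m)\Omega_R\vdash C_r$ if $\mathsf{C}^\rightarrow\in\sigma(m)$; ($\mathsf{W}$) $\Omega_L\Omega_R\vdash C_r\Rightarrow\Omega_L(x{:}A_m)\Omega_R\vdash C_r$ if $\mathsf{W}\in\sigma(m)$. Natural deduction with explicit structural rules: judgment $\Gamma\vdash A_m\dashv\Omega$, $\Gamma$ an unordered set of labeled hypotheses, $\Omega$ the ordered context of used hypotheses. Rules: (hyp) $x{:}A_m\in\Gamma\Rightarrow\Gamma\vdash A_m\dashv(x{:}A_m)$; ($1I$) $\Rightarrow\Gamma\vdash1_m\dashv\cdot$; ($1E$) $\Gamma\vdash1_m\dashv\Omega_M$, $m\geq r$, $\Gamma\vdash C_r\dashv\Omega_L\Omega_R\Rightarrow\Gamma\vdash C_r\dashv\Omega_L\Omega_M\Omega_R$; ($\bullet I$) $\Gamma\vdash A_m\dashv\Omega_L,\Gamma\vdash B_m\dashv\Omega_R\Rightarrow\Gamma\vdash A_m\bullet B_m\dashv\Omega_L\Omega_R$; ($\bullet E$) $\Gamma\vdash A_m\bullet B_m\dashv\Omega_M$, $m\geq r$, $x,y\notin|\Omega_L\Omega_R|$, $\Gamma,x{:}A_m,y{:}B_m\vdash C_r\dashv\Omega_L(x{:}A_m)(y{:}B_m)\Omega_R\Rightarrow\Gamma\vdash C_r\dashv\Omega_L\Omega_M\Omega_R$; ($\oplus I_i$) $\Gamma\vdash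 A_m\dashv\Omega$ (resp. $B_m$) $\Rightarrow\Gamma\vdash A_m\oplus B_m\dashv\Omega$; ($\oplus E$) $\Gamma\vdash A_m\oplus B_m\dashv\Omega_M$, $m\geq r$, $x\notin|\Omega_L\Omega_R|$, $\Gamma,x{:}A_m\vdash C_r\dashv\Omega_L(x{:}A_m)\Omega_R$, $\Gamma,x{:}B_m\vdash C_r\dashv\Omega_L(x{:}B_m)\Omega_R\Rightarrow\Gamma\vdash C_r\dashv\Omega_L\Omega_M\Omega_R$; (${\downarrow}I$) $\Gamma\vdash A_k\dashv\Omega\Rightarrow\Gamma\vdash{\downarrow}^k_mA_k\dashv\Omega$; (${\downarrow}E$) $\Gamma\vdash{\downarrow}^k_mA_k\dashv\Omega_M$, $m\geq r$, $\Gamma,x{:}A_k\vdash C_r\dashv\Omega_L(x{:}A_k)\Omega_R$, $x\notin|\Omega_L\Omega_R|\Rightarrow\Gamma\vdash C_r\dashv\Omega_L\Omega_M\Omega_R$; ($\twoheadrightarrow I$) $\Gamma,x{:}A_m\vdash B_m\dashv\Omega(x{:}A_m)$, $x\notin|\Omega|\Rightarrow\Gamma\vdash A_m\twoheadrightarrow B_m\dashv\Omega$; ($\twoheadrightarrow E$) $\Gamma\vdash A_m\twoheadrightarrow B_m\dashv\Omega_L,\Gamma\vdash A_m\dashv\Omega_R\Rightarrow\Gamma\vdash B_m\dashv\Omega_L\Omega_R$; ($\rightarrowtail I$) $\Gamma,x{:}A_m\vdash B_m\dashv(x{:}A_m)\Omega$, $x\notin|\Omega|\Rightarrow\Gamma\vdash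 A_m\rightarrowtail B_m\dashv\Omega$; ($\rightarrowtail E$) $\Gamma\vdash A_m\rightarrowtail B_m\dashv\Omega_R,\Gamma\vdash A_m\dashv\Omega_L\Rightarrow\Gamma\vdash B_m\dashv\Omega_L\Omega_R$; ($\&I$) $\Gamma\vdash A_m\dashv\Omega,\Gamma\vdash B_m\dashv\Omega\Rightarrow\Gamma\vdash A_m\&B_m\dashv\Omega$; ($\&E_i$) $\Gamma\vdash A_m\&B_m\dashv\Omega\Rightarrow\Gamma\vdash A_m\dashv\Omega$ (resp. $B_m$); (${\uparrow}I$) $\Gamma\vdash A_l\dashv\Omega$, $\Omega\geq m\Rightarrow\Gamma\vdash{\uparrow}^m_lA_l\dashv\Omega$; (${\uparrow}E$) $\Gamma\vdash{\uparrow}^l_kA_k\dashv\Omega\Rightarrow\Gamma\vdash A_k\dashv\Omega$; structural: ($\mathsf{W}$) $\Gamma\vdash C_r\dashv\Omega_L\Omega_R$, $x{:}A_m\in\Gamma$, $m\geq r$, $\mathsf{W}\in\sigma(m)\Rightarrow\Gamma\vdash C_r\dashv\Omega_L(x{:}A_m)\Omega_R$; ($\mathsf{C}^\rightarrow$) $\Gamma\vdash C_r\dashv\Omega_L(x{:}A_m)\Omega_M(x{:}A_m)\Omega_R$, $\mathsf{C}^\rightarrow\in\sigma(m)\Rightarrow\Gamma\vdash C_r\dashv\Omega_L\Omega_M(x{:}A_m)\Omega_R$; ($\mathsf{C}^\leftarrow$) same premise, $\mathsf{C}^\leftarrow\in\sigma(m)\Rightarrow\Gamma\vdash C_r\dashv\Omega_L(x{:}A_m)\Omega_M\Omega_R$;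 ($\mathsf{M}^\rightarrow$) $\Gamma\vdash C_r\dashv\Omega_L(x{:}A_m)\Omega_M\Omega_R$, $\mathsf{M}^\rightarrow\in\sigma(m)\Rightarrow\Gamma\vdash C_r\dashv\Omega_L\Omega_M(x{:}A_m)\Omega_R$; ($\mathsf{M}^\leftarrow$) $\Gamma\vdash C_r\dashv\Omega_L\Omega_M(x{:}A_m)\Omega_R$, $\mathsf{M}^\leftarrow\in\sigma(m)\Rightarrow\Gamma\vdash C_r\dashv\Omega_L(x{:}A_m)\Omega_M\Omega_R$. -}

module Defs where

open import Level using (Level; _⊔_; suc)
open import Data.Nat using (ℕ)
open import Data.List using (List; []; _∷_; _++_; [_])
open import Data.List.Relation.Unary.All using (All)
open import Data.List.Membership.Propositional using (_∈_; _∉_)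
open import Relation.Binary.PropositionalEquality using (_≡_)
open import Relation.Binary.Structures using (IsPreorder)
open import Relation.Nullary using (¬_)

data Struct : Set where
  𝖶 𝖢← 𝖢→ 𝖬← 𝖬→ : Struct

-- A preorder of modes (M, ≥) together with a monotone assignment
-- σ(m) ⊆ {W, C←, C→, M←, M→}  (σ m s  means  s ∈ σ(m)).
record ModeSystem (a ℓ : Level) : Set (suc (a ⊔ ℓ)) where
  field
    Mode       : Set a
    _≥_        : Mode → Mode → Set ℓ
    isPreorder : IsPreorder _≡_ _≥_
    σ          : Mode → Struct → Set ℓ
    σ-mono     : ∀ {k m s} → k ≥ m → σ m s → σ k s

module Calculus {a ℓ : Level} (S : ModeSystem a ℓ) where
  open ModeSystem S

  infixr 7 _•_
  infixr 6 _&_ _⊕_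
  infixr 5 _↣_ _↠_

  data Prop : Mode → Set (a ⊔ ℓ) where
    atom : ∀ {m} → ℕ → Prop m
    _↣_  : ∀ {m} → Prop m → Prop m → Prop m
    _↠_  : ∀ {m} → Prop m → Prop m → Prop m
    _&_  : ∀ {m} → Prop m → Prop m → Prop m
    ↑    : ∀ {m} (l : Mode) → m ≥ l → Prop l → Prop m
    _•_  : ∀ {m} → Prop m → Prop m → Prop m
    𝟙    : ∀ {m} → Prop m
    _⊕_  : ∀ {m} → Prop m → Prop m → Prop m
    ↓    : ∀ {m} (k : Mode) → k ≥ m → Prop k → Prop m

  -- Variables are Church-typed: a variable is a
  -- name together with its proposition, which realizes the convention that
  -- each variable always labels the same proposition.
  infix 8 _∶_
  data Hyp : Set (a ⊔ ℓ) where
    _∶_ : (x : ℕ) {m : Mode} (A : Prop m) → Hyp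

  modeOf : Hyp → Mode
  modeOf (_∶_ _ {m} _) = m

  -- Ordered contexts (also used, with set semantics via membership, for Γ).
  Ctx : Set (a ⊔ ℓ)
  Ctx = List Hyp

  _≥ᶜ_ : Ctx → Mode → Set (a ⊔ ℓ)
  Ω ≥ᶜ m = All (λ h → modeOf h ≥ m) Ω

  -- Sequent calculus  Ω ⊢ C_r.  Every constructor carries the
  -- presupposition Ω ≥ r of its conclusion; variables new in the premises
  -- are required fresh for the conclusion's context.

  infix 3 _⊢ˢ_
  data _⊢ˢ_ : Ctx → ∀ {r} → Prop r → Set (a ⊔ ℓ) where
    id  : ∀ {m x} {A : Prop m} →
          [ x ∶ A ] ≥ᶜ m →
          [ x ∶ A ] ⊢ˢ A
    cut : ∀ {m r x ΩA ΩL ΩR} {A : Prop m} {C : Prop r} →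
          (ΩL ++ ΩA ++ ΩR) ≥ᶜ r →
          ΩA ⊢ˢ A → (ΩL ++ x ∶ A ∷ ΩR) ⊢ˢ C →
          ΩA ≥ᶜ m → m ≥ r → (x ∶ A) ∉ (ΩL ++ ΩA ++ ΩR) →
          (ΩL ++ ΩA ++ ΩR) ⊢ˢ C
    𝟙R  : ∀ {m} → [] ≥ᶜ m → [] ⊢ˢ 𝟙 {m}
    𝟙L  : ∀ {m r x ΩL ΩR} {C : Prop r} →
          (ΩL ++ x ∶ 𝟙 {m} ∷ ΩR) ≥ᶜ r →
          (ΩL ++ ΩR) ⊢ˢ C →
          (ΩL ++ x ∶ 𝟙 {m} ∷ ΩR) ⊢ˢ C
    •R  : ∀ {m Ω₁ Ω₂} {A B : Prop m} →
          (Ω₁ ++ Ω₂) ≥ᶜ m →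
          Ω₁ ⊢ˢ A → Ω₂ ⊢ˢ B → (Ω₁ ++ Ω₂) ⊢ˢ A • B
    •L  : ∀ {m r x x₁ x₂ ΩL ΩR} {A B : Prop m} {C : Prop r} →
          (ΩL ++ x ∶ (A • B) ∷ ΩR) ≥ᶜ r →
          (ΩL ++ x₁ ∶ A ∷ x₂ ∶ B ∷ ΩR) ⊢ˢ C →
          (x₁ ∶ A) ∉ (ΩL ++ x ∶ (A • B) ∷ ΩR) →
          (x₂ ∶ B) ∉ (ΩL ++ x ∶ (A • B) ∷ ΩR) →
          ¬ (x₁ ∶ A ≡ x₂ ∶ B) →
          (ΩL ++ x ∶ (A • B) ∷ ΩR) ⊢ˢ C
    ⊕R₁ : ∀ {m Ω} {A B : Prop m} → Ω ≥ᶜ m → Ω ⊢ˢ A → Ω ⊢ˢ A ⊕ B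
    ⊕R₂ : ∀ {m Ω} {A B : Prop m} → Ω ≥ᶜ m → Ω ⊢ˢ B → Ω ⊢ˢ A ⊕ B
    ⊕L  : ∀ {m r x y ΩL ΩR} {A B : Prop m} {C : Prop r} →
          (ΩL ++ x ∶ (A ⊕ B) ∷ ΩR) ≥ᶜ r →
          (ΩL ++ y ∶ A ∷ ΩR) ⊢ˢ C → (ΩL ++ y ∶ B ∷ ΩR) ⊢ˢ C →
          (y ∶ A) ∉ (ΩL ++ x ∶ (A ⊕ B) ∷ ΩR) →
          (y ∶ B) ∉ (ΩL ++ x ∶ (A ⊕ B) ∷ ΩR) →
          (ΩL ++ x ∶ (A ⊕ B) ∷ ΩR) ⊢ˢ C
    ↓R  : ∀ {k m Ω} {p : k ≥ m} {A : Prop k} →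
          Ω ≥ᶜ m →
          Ω ⊢ˢ A → Ω ≥ᶜ k → Ω ⊢ˢ ↓ k p A
    ↓L  : ∀ {k m r x y ΩL ΩR} {p : k ≥ m} {A : Prop k} {C : Prop r} →
          (ΩL ++ x ∶ ↓ k p A ∷ ΩR) ≥ᶜ r →
          (ΩL ++ y ∶ A ∷ ΩR) ⊢ˢ C →
          (y ∶ A) ∉ (ΩL ++ x ∶ ↓ k p A ∷ ΩR) →
          (ΩL ++ x ∶ ↓ k p A ∷ ΩR) ⊢ˢ C
    ↠R  : ∀ {m x Ω} {A B : Prop m} →
          Ω ≥ᶜ m →
          (Ω ++ [ x ∶ A ]) ⊢ˢ B → (x ∶ A) ∉ Ω →
          Ω ⊢ˢ A ↠ B
    ↠L  : ∀ {m r f y ΩA ΩL ΩR} {A B : Prop m} {C : Prop r} →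
          (ΩL ++ f ∶ (A ↠ B) ∷ ΩA ++ ΩR) ≥ᶜ r →
          ΩA ⊢ˢ A → ΩA ≥ᶜ m → (ΩL ++ y ∶ B ∷ ΩR) ⊢ˢ C →
          (y ∶ B) ∉ (ΩL ++ f ∶ (A ↠ B) ∷ ΩA ++ ΩR) →
          (ΩL ++ f ∶ (A ↠ B) ∷ ΩA ++ ΩR) ⊢ˢ C
    ↣R  : ∀ {m x Ω} {A B : Prop m} →
          Ω ≥ᶜ m →
          (x ∶ A ∷ Ω) ⊢ˢ B → (x ∶ A) ∉ Ω →
          Ω ⊢ˢ A ↣ B
    ↣L  : ∀ {m r f y ΩA ΩL ΩR} {A B : Prop m} {C : Prop r} →
          (ΩL ++ ΩA ++ f ∶ (A ↣ B) ∷ ΩR) ≥ᶜ r →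
          ΩA ⊢ˢ A → ΩA ≥ᶜ m → (ΩL ++ y ∶ B ∷ ΩR) ⊢ˢ C →
          (y ∶ B) ∉ (ΩL ++ ΩA ++ f ∶ (A ↣ B) ∷ ΩR) →
          (ΩL ++ ΩA ++ f ∶ (A ↣ B) ∷ ΩR) ⊢ˢ C
    &R  : ∀ {m Ω} {A B : Prop m} →
          Ω ≥ᶜ m →
          Ω ⊢ˢ A → Ω ⊢ˢ B → Ω ⊢ˢ A & B
    &L₁ : ∀ {m r x y ΩL ΩR} {A B : Prop m} {C : Prop r} →
          (ΩL ++ x ∶ (A & B) ∷ ΩR) ≥ᶜ r →
          (ΩL ++ y ∶ A ∷ ΩR) ⊢ˢ C →
          (y ∶ A) ∉ (ΩL ++ x ∶ (A & B) ∷ ΩR) →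
          (ΩL ++ x ∶ (A & B) ∷ ΩR) ⊢ˢ C
    &L₂ : ∀ {m r x y ΩL ΩR} {A B : Prop m} {C : Prop r} →
          (ΩL ++ x ∶ (A & B) ∷ ΩR) ≥ᶜ r →
          (ΩL ++ y ∶ B ∷ ΩR) ⊢ˢ C →
          (y ∶ B) ∉ (ΩL ++ x ∶ (A & B) ∷ ΩR) →
          (ΩL ++ x ∶ (A & B) ∷ ΩR) ⊢ˢ C
    ↑R  : ∀ {m l Ω} {p : m ≥ l} {A : Prop l} →
          Ω ≥ᶜ m →
          Ω ⊢ˢ A → Ω ⊢ˢ ↑ l p A
    ↑L  : ∀ {m l r x y ΩL ΩR} {p : m ≥ l} {A : Prop l} {C : Prop r} →
          (ΩL ++ x ∶ ↑ l p A ∷ ΩR) ≥ᶜ r →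
          (ΩL ++ y ∶ A ∷ ΩR) ⊢ˢ C → l ≥ r →
          (y ∶ A) ∉ (ΩL ++ x ∶ ↑ l p A ∷ ΩR) →
          (ΩL ++ x ∶ ↑ l p A ∷ ΩR) ⊢ˢ C
    M←  : ∀ {m r x ΩL ΩM ΩR} {A : Prop m} {C : Prop r} →
          (ΩL ++ x ∶ A ∷ ΩM ++ ΩR) ≥ᶜ r →
          (ΩL ++ ΩM ++ x ∶ A ∷ ΩR) ⊢ˢ C → σ m 𝖬← →
          (ΩL ++ x ∶ A ∷ ΩM ++ ΩR) ⊢ˢ C
    M→  : ∀ {m r x ΩL ΩM ΩR} {A : Prop m} {C : Prop r} →
          (ΩL ++ ΩM ++ x ∶ A ∷ ΩR) ≥ᶜ r →
          (ΩL ++ x ∶ A ∷ ΩM ++ ΩR) ⊢ˢ C → σ m 𝖬→ →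
          (ΩL ++ ΩM ++ x ∶ A ∷ ΩR) ⊢ˢ C
    C←  : ∀ {m r x ΩL ΩM ΩR} {A : Prop m} {C : Prop r} →
          (ΩL ++ x ∶ A ∷ ΩM ++ ΩR) ≥ᶜ r →
          (ΩL ++ x ∶ A ∷ ΩM ++ x ∶ A ∷ ΩR) ⊢ˢ C → σ m 𝖢← →
          (ΩL ++ x ∶ A ∷ ΩM ++ ΩR) ⊢ˢ C
    C→  : ∀ {m r x ΩL ΩM ΩR} {A : Prop m} {C : Prop r} →
          (ΩL ++ ΩM ++ x ∶ A ∷ ΩR) ≥ᶜ r →
          (ΩL ++ x ∶ A ∷ ΩM ++ x ∶ A ∷ ΩR) ⊢ˢ C → σ m 𝖢→ →
          (ΩL ++ ΩM ++ x ∶ A ∷ ΩR) ⊢ˢ C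
    Wk  : ∀ {m r x ΩL ΩR} {A : Prop m} {C : Prop r} →
          (ΩL ++ x ∶ A ∷ ΩR) ≥ᶜ r →
          (ΩL ++ ΩR) ⊢ˢ C → σ m 𝖶 →
          (ΩL ++ x ∶ A ∷ ΩR) ⊢ˢ C

  -- Natural deduction with explicit structural rules  Γ ⊢ A_m ⊣ Ω.
  -- Γ is a set of labeled hypotheses (a list read up to membership);
  -- Γ, x:A is  x ∶ A ∷ Γ.

  infix 3 _⊢_⊣_
  data _⊢_⊣_ : Ctx → ∀ {r} → Prop r → Ctx → Set (a ⊔ ℓ) where
    hyp  : ∀ {Γ m x} {A : Prop m} →
           (x ∶ A) ∈ Γ → Γ ⊢ A ⊣ [ x ∶ A ]
    𝟙I   : ∀ {Γ m} → Γ ⊢ 𝟙 {m} ⊣ []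
    𝟙E   : ∀ {Γ m r ΩL ΩM ΩR} {C : Prop r} →
           Γ ⊢ 𝟙 {m} ⊣ ΩM → m ≥ r → Γ ⊢ C ⊣ (ΩL ++ ΩR) →
           Γ ⊢ C ⊣ (ΩL ++ ΩM ++ ΩR)
    •I   : ∀ {Γ m ΩL ΩR} {A B : Prop m} →
           Γ ⊢ A ⊣ ΩL → Γ ⊢ B ⊣ ΩR → Γ ⊢ A • B ⊣ (ΩL ++ ΩR)
    •E   : ∀ {Γ m r x y ΩL ΩM ΩR} {A B : Prop m} {C : Prop r} →
           Γ ⊢ A • B ⊣ ΩM → m ≥ r →
           (x ∶ A) ∉ (ΩL ++ ΩR) → (y ∶ B) ∉ (ΩL ++ ΩR) →
           (y ∶ B ∷ x ∶ A ∷ Γ) ⊢ C ⊣ (ΩL ++ x ∶ A ∷ y ∶ B ∷ ΩR) →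
           Γ ⊢ C ⊣ (ΩL ++ ΩM ++ ΩR)
    ⊕I₁  : ∀ {Γ m Ω} {A B : Prop m} → Γ ⊢ A ⊣ Ω → Γ ⊢ A ⊕ B ⊣ Ω
    ⊕I₂  : ∀ {Γ m Ω} {A B : Prop m} → Γ ⊢ B ⊣ Ω → Γ ⊢ A ⊕ B ⊣ Ω
    ⊕E   : ∀ {Γ m r x ΩL ΩM ΩR} {A B : Prop m} {C : Prop r} →
           Γ ⊢ A ⊕ B ⊣ ΩM → m ≥ r →
           (x ∶ A) ∉ (ΩL ++ ΩR) → (x ∶ B) ∉ (ΩL ++ ΩR) →
           (x ∶ A ∷ Γ) ⊢ C ⊣ (ΩL ++ x ∶ A ∷ ΩR) →
           (x ∶ B ∷ Γ) ⊢ C ⊣ (ΩL ++ x ∶ B ∷ ΩR) →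
           Γ ⊢ C ⊣ (ΩL ++ ΩM ++ ΩR)
    ↓I   : ∀ {Γ k m Ω} {p : k ≥ m} {A : Prop k} →
           Γ ⊢ A ⊣ Ω → Γ ⊢ ↓ k p A ⊣ Ω
    ↓E   : ∀ {Γ k m r x ΩL ΩM ΩR} {p : k ≥ m} {A : Prop k} {C : Prop r} →
           Γ ⊢ ↓ k p A ⊣ ΩM → m ≥ r →
           (x ∶ A ∷ Γ) ⊢ C ⊣ (ΩL ++ x ∶ A ∷ ΩR) →
           (x ∶ A) ∉ (ΩL ++ ΩR) →
           Γ ⊢ C ⊣ (ΩL ++ ΩM ++ ΩR)
    ↠I   : ∀ {Γ m x Ω} {A B : Prop m} →
           (x ∶ A ∷ Γ) ⊢ B ⊣ (Ω ++ [ x ∶ A ]) → (x ∶ A) ∉ Ω →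
           Γ ⊢ A ↠ B ⊣ Ω
    ↠E   : ∀ {Γ m ΩL ΩR} {A B : Prop m} →
           Γ ⊢ A ↠ B ⊣ ΩL → Γ ⊢ A ⊣ ΩR → Γ ⊢ B ⊣ (ΩL ++ ΩR)
    ↣I   : ∀ {Γ m x Ω} {A B : Prop m} →
           (x ∶ A ∷ Γ) ⊢ B ⊣ (x ∶ A ∷ Ω) → (x ∶ A) ∉ Ω →
           Γ ⊢ A ↣ B ⊣ Ω
    ↣E   : ∀ {Γ m ΩL ΩR} {A B : Prop m} →
           Γ ⊢ A ↣ B ⊣ ΩR → Γ ⊢ A ⊣ ΩL → Γ ⊢ B ⊣ (ΩL ++ ΩR)
    &I   : ∀ {Γ m Ω} {A B : Prop m} →
           Γ ⊢ A ⊣ Ω → Γ ⊢ B ⊣ Ω → Γ ⊢ A & B ⊣ Ω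
    &E₁  : ∀ {Γ m Ω} {A B : Prop m} → Γ ⊢ A & B ⊣ Ω → Γ ⊢ A ⊣ Ω
    &E₂  : ∀ {Γ m Ω} {A B : Prop m} → Γ ⊢ A & B ⊣ Ω → Γ ⊢ B ⊣ Ω
    ↑I   : ∀ {Γ m l Ω} {p : m ≥ l} {A : Prop l} →
           Γ ⊢ A ⊣ Ω → Ω ≥ᶜ m → Γ ⊢ ↑ l p A ⊣ Ω
    ↑E   : ∀ {Γ l k Ω} {p : l ≥ k} {A : Prop k} →
           Γ ⊢ ↑ k p A ⊣ Ω → Γ ⊢ A ⊣ Ω
    Wᴺ   : ∀ {Γ m r x ΩL ΩR} {A : Prop m} {C : Prop r} →
           Γ ⊢ C ⊣ (ΩL ++ ΩR) → (x ∶ A) ∈ Γ → m ≥ r → σ m 𝖶 →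
           Γ ⊢ C ⊣ (ΩL ++ x ∶ A ∷ ΩR)
    C→ᴺ  : ∀ {Γ m r x ΩL ΩM ΩR} {A : Prop m} {C : Prop r} →
           Γ ⊢ C ⊣ (ΩL ++ x ∶ A ∷ ΩM ++ x ∶ A ∷ ΩR) → σ m 𝖢→ →
           Γ ⊢ C ⊣ (ΩL ++ ΩM ++ x ∶ A ∷ ΩR)
    C←ᴺ  : ∀ {Γ m r x ΩL ΩM ΩR} {A : Prop m} {C : Prop r} →
           Γ ⊢ C ⊣ (ΩL ++ x ∶ A ∷ ΩM ++ x ∶ A ∷ ΩR) → σ m 𝖢← →
           Γ ⊢ C ⊣ (ΩL ++ x ∶ A ∷ ΩM ++ ΩR)
    M→ᴺ  : ∀ {Γ m r x ΩL ΩM ΩR} {A : Prop m} {C : Prop r} →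
           Γ ⊢ C ⊣ (ΩL ++ x ∶ A ∷ ΩM ++ ΩR) → σ m 𝖬→ →
           Γ ⊢ C ⊣ (ΩL ++ ΩM ++ x ∶ A ∷ ΩR)
    M←ᴺ  : ∀ {Γ m r x ΩL ΩM ΩR} {A : Prop m} {C : Prop r} →
           Γ ⊢ C ⊣ (ΩL ++ ΩM ++ x ∶ A ∷ ΩR) → σ m 𝖬← →
           Γ ⊢ C ⊣ (ΩL ++ x ∶ A ∷ ΩM ++ ΩR)

-- Right rules of the sequent calculus are introduction rules, and the
-- structural rules have literal counterparts.  A left rule on x : A becomes
-- an elimination applied to the hypothesis x, either directly (𝟙, •, ⊕, ↓)
-- or followed by a substitution of the result for the new hypothesis
-- (&, ↑, ↠, ↣).  Natural deduction has no substitution rule, but ↓E on the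
-- identity shift ↓^m_m internalises it, and cut is translated the same way.
-- The side condition m ≥ r of each elimination is read off the presupposition
-- Ω ≥ r of the sequent at the principal hypothesis.
-- Since left rules enlarge the set of available hypotheses, the translation
-- is carried out for every Γ covering the used context Ω at once.
module Submission where

open import Defs
open import Level using (Level; _⊔_)
open import Function using (_∘_; flip)
open import Data.List using (List; []; _∷_; _++_; [_])
open import Data.List.Properties using (++-assoc; ++-identityʳ)
open import Data.List.Membership.Propositional using (_∈_; _∉_)
open import Data.List.Membership.Propositional.Properties using (∈-++⁺ʳ; ∈-insert)
open import Data.List.Relation.Unary.Any using (here)
open import Data.List.Relation.Unary.All using (lookup)
open import Data.List.Relation.Binary.Subset.Propositional using (_⊆_)
open import Data.List.Relation.Binary.Subset.Propositional.Properties
  using ( ⊆-refl; ⊆-reflexive; ⊆-reflexive-↭; xs⊆xs++ys; xs⊆ys++xs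
        ; ++⁺ʳ; ∷⁺ʳ; ∈-∷⁺ʳ )
open import Data.List.Relation.Binary.Permutation.Propositional
  using (_↭_; ↭-refl; ↭-sym; swap)
open import Data.List.Relation.Binary.Permutation.Propositional.Properties
  using (shift; ++⁺ˡ)
open import Relation.Binary.PropositionalEquality using (_≡_; refl; cong; subst)
open import Relation.Binary.Structures using (IsPreorder)

module _ {a : Level} {X : Set a} where

  ⊆-middle : ∀ (ΩL ΩM ΩR : List X) → ΩM ⊆ ΩL ++ ΩM ++ ΩR
  ⊆-middle ΩL ΩM ΩR = xs⊆ys++xs (ΩM ++ ΩR) ΩL ∘ xs⊆xs++ys ΩM ΩR

  ⊆-insert : ∀ (ΩL ΩM ΩR : List X) → ΩL ++ ΩR ⊆ ΩL ++ ΩM ++ ΩR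
  ⊆-insert ΩL ΩM ΩR = ++⁺ʳ ΩL (xs⊆ys++xs ΩR ΩM)

  ⊆-bind : ∀ (ΩL ΩR : List X) {x : X} {Γ : List X} →
           ΩL ++ ΩR ⊆ Γ → ΩL ++ x ∷ ΩR ⊆ x ∷ Γ
  ⊆-bind ΩL ΩR s = ∷⁺ʳ _ s ∘ ⊆-reflexive-↭ (shift _ ΩL ΩR)

  ⊆-bind₂ : ∀ (ΩL ΩR : List X) {x y : X} {Γ : List X} →
            ΩL ++ ΩR ⊆ Γ → ΩL ++ x ∷ y ∷ ΩR ⊆ y ∷ x ∷ Γ
  ⊆-bind₂ ΩL ΩR s =
    ⊆-reflexive-↭ (swap _ _ ↭-refl) ∘ ⊆-bind ΩL (_ ∷ ΩR) (⊆-bind ΩL ΩR s)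

  ↭-move : ∀ (ΩL ΩM : List X) (x : X) (ΩR : List X) →
           ΩL ++ ΩM ++ x ∷ ΩR ↭ ΩL ++ x ∷ ΩM ++ ΩR
  ↭-move ΩL ΩM x ΩR = ++⁺ˡ ΩL (shift x ΩM ΩR)

  ⊆-contractˡ : ∀ (ΩL ΩM : List X) (x : X) (ΩR : List X) →
                ΩL ++ x ∷ ΩM ++ x ∷ ΩR ⊆ ΩL ++ x ∷ ΩM ++ ΩR
  ⊆-contractˡ ΩL ΩM x ΩR =
    ++⁺ʳ ΩL (∈-∷⁺ʳ (here refl) (⊆-reflexive-↭ (shift x ΩM ΩR)))

  ⊆-contractʳ : ∀ (ΩL ΩM : List X) (x : X) (ΩR : List X) →
                ΩL ++ x ∷ ΩM ++ x ∷ ΩR ⊆ ΩL ++ ΩM ++ x ∷ ΩR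
  ⊆-contractʳ ΩL ΩM x ΩR = ++⁺ʳ ΩL (∈-∷⁺ʳ (∈-insert ΩM) ⊆-refl)

module Translation {a ℓ : Level} (S : ModeSystem a ℓ) where
  open ModeSystem S
  open Calculus S

  ≥-refl : ∀ {m} → m ≥ m
  ≥-refl = IsPreorder.refl isPreorder

  cutᴺ : ∀ {Γ m r x ΩL ΩM ΩR} {A : Prop m} {C : Prop r} →
         Γ ⊢ A ⊣ ΩM → m ≥ r →
         (x ∶ A ∷ Γ) ⊢ C ⊣ (ΩL ++ x ∶ A ∷ ΩR) → (x ∶ A) ∉ (ΩL ++ ΩR) →
         Γ ⊢ C ⊣ (ΩL ++ ΩM ++ ΩR)
  cutᴺ {ΩL = ΩL} {ΩR = ΩR} d m≥r e x∉ =
    ↓E {ΩL = ΩL} {ΩR = ΩR} (↓I {p = ≥-refl} d) m≥r e x∉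

  infix 3 _⊩_
  _⊩_ : Ctx → ∀ {r} → Prop r → Set (a ⊔ ℓ)
  Ω ⊩ A = (Γ : Ctx) → Ω ⊆ Γ → Γ ⊢ A ⊣ Ω

  hyp⊩ : ∀ {m x} {A : Prop m} → [ x ∶ A ] ⊩ A
  hyp⊩ Γ s = hyp (s (here refl))

  map⊩ : ∀ {m n Ω₁ Ω₂} {A : Prop m} {B : Prop n} →
         Ω₁ ⊆ Ω₂ → (∀ {Γ} → Γ ⊢ A ⊣ Ω₁ → Γ ⊢ B ⊣ Ω₂) →
         Ω₁ ⊩ A → Ω₂ ⊩ B
  map⊩ Ω₁⊆Ω₂ rule d Γ s = rule (d Γ (s ∘ Ω₁⊆Ω₂))

  ++⊩ : ∀ {m Ω₁ Ω₂} {A B C : Prop m} →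
        (∀ {Γ} → Γ ⊢ A ⊣ Ω₁ → Γ ⊢ B ⊣ Ω₂ → Γ ⊢ C ⊣ Ω₁ ++ Ω₂) →
        Ω₁ ⊩ A → Ω₂ ⊩ B → Ω₁ ++ Ω₂ ⊩ C
  ++⊩ {Ω₁ = Ω₁} {Ω₂} rule d e Γ s =
    rule (d Γ (s ∘ xs⊆xs++ys Ω₁ Ω₂)) (e Γ (s ∘ xs⊆ys++xs Ω₂ Ω₁))

  cut⊩ : ∀ ΩL {ΩM} ΩR {m r x} {A : Prop m} {C : Prop r} →
         ΩM ⊩ A → m ≥ r → (x ∶ A) ∉ (ΩL ++ ΩM ++ ΩR) →
         (ΩL ++ x ∶ A ∷ ΩR) ⊩ C → (ΩL ++ ΩM ++ ΩR) ⊩ C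
  cut⊩ ΩL {ΩM} ΩR d m≥r x∉ e Γ s =
    cutᴺ {ΩL = ΩL} {ΩR = ΩR} (d Γ (s ∘ ⊆-middle ΩL ΩM ΩR)) m≥r
         (e _ (⊆-bind ΩL ΩR (s ∘ ⊆-insert ΩL ΩM ΩR)))
         (x∉ ∘ ⊆-insert ΩL ΩM ΩR)

  sequent⇒natural : ∀ {r Ω} {A : Prop r} → Ω ⊢ˢ A → Ω ⊩ A
  sequent⇒natural (id _) = hyp⊩
  sequent⇒natural (cut {ΩL = ΩL} {ΩR} _ d e _ m≥r x∉) =
    cut⊩ ΩL ΩR (sequent⇒natural d) m≥r x∉ (sequent⇒natural e)
  sequent⇒natural (𝟙R _) Γ s = 𝟙I
  sequent⇒natural (𝟙L {ΩL = ΩL} {ΩR} pre d) Γ s =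
    𝟙E {ΩL = ΩL} {ΩR = ΩR} (hyp (s (∈-insert ΩL))) (lookup pre (∈-insert ΩL))
       (sequent⇒natural d Γ (s ∘ ⊆-insert ΩL _ ΩR))
  sequent⇒natural (•R _ d e) = ++⊩ •I (sequent⇒natural d) (sequent⇒natural e)
  sequent⇒natural (•L {ΩL = ΩL} {ΩR} pre d x₁∉ x₂∉ _) Γ s =
    •E {ΩL = ΩL} {ΩR = ΩR} (hyp (s (∈-insert ΩL))) (lookup pre (∈-insert ΩL))
       (x₁∉ ∘ ⊆-insert ΩL _ ΩR) (x₂∉ ∘ ⊆-insert ΩL _ ΩR)
       (sequent⇒natural d _ (⊆-bind₂ ΩL ΩR (s ∘ ⊆-insert ΩL _ ΩR)))
  sequent⇒natural (⊕R₁ _ d) = map⊩ ⊆-refl ⊕I₁ (sequent⇒natural d)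
  sequent⇒natural (⊕R₂ _ d) = map⊩ ⊆-refl ⊕I₂ (sequent⇒natural d)
  sequent⇒natural (⊕L {ΩL = ΩL} {ΩR} pre d e y∉₁ y∉₂) Γ s =
    ⊕E {ΩL = ΩL} {ΩR = ΩR} (hyp (s (∈-insert ΩL))) (lookup pre (∈-insert ΩL))
       (y∉₁ ∘ ⊆-insert ΩL _ ΩR) (y∉₂ ∘ ⊆-insert ΩL _ ΩR)
       (sequent⇒natural d _ (⊆-bind ΩL ΩR (s ∘ ⊆-insert ΩL _ ΩR)))
       (sequent⇒natural e _ (⊆-bind ΩL ΩR (s ∘ ⊆-insert ΩL _ ΩR)))
  sequent⇒natural (↓R _ d _) = map⊩ ⊆-refl ↓I (sequent⇒natural d)
  sequent⇒natural (↓L {ΩL = ΩL} {ΩR} pre d y∉) Γ s =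
    ↓E {ΩL = ΩL} {ΩR = ΩR} (hyp (s (∈-insert ΩL))) (lookup pre (∈-insert ΩL))
       (sequent⇒natural d _ (⊆-bind ΩL ΩR (s ∘ ⊆-insert ΩL _ ΩR)))
       (y∉ ∘ ⊆-insert ΩL _ ΩR)
  sequent⇒natural (↠R {Ω = Ω} _ d x∉) Γ s =
    ↠I (sequent⇒natural d _ (⊆-bind Ω [] (s ∘ ⊆-reflexive (++-identityʳ Ω)))) x∉
  sequent⇒natural (↠L {ΩL = ΩL} {ΩR} pre d _ e y∉) =
    cut⊩ ΩL ΩR (++⊩ ↠E hyp⊩ (sequent⇒natural d)) (lookup pre (∈-insert ΩL))
         y∉ (sequent⇒natural e)
  sequent⇒natural (↣R _ d x∉) Γ s = ↣I (sequent⇒natural d _ (∷⁺ʳ _ s)) x∉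
  sequent⇒natural (↣L {f = f} {ΩA = ΩA} {ΩL} {ΩR} {A = A} {B} pre d _ e y∉) =
    subst (_⊩ _) ΩL++ΩA++f∷ΩR
      (cut⊩ ΩL ΩR (++⊩ (flip ↣E) (sequent⇒natural d) hyp⊩)
            (lookup pre (∈-++⁺ʳ ΩL (∈-insert ΩA)))
            (y∉ ∘ subst (_ ∈_) ΩL++ΩA++f∷ΩR) (sequent⇒natural e))
    where
    ΩL++ΩA++f∷ΩR : ΩL ++ (ΩA ++ [ f ∶ (A ↣ B) ]) ++ ΩR
                 ≡ ΩL ++ ΩA ++ f ∶ (A ↣ B) ∷ ΩR
    ΩL++ΩA++f∷ΩR = cong (ΩL ++_) (++-assoc ΩA _ ΩR)
  sequent⇒natural (&R _ d e) Γ s =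
    &I (sequent⇒natural d Γ s) (sequent⇒natural e Γ s)
  sequent⇒natural (&L₁ {ΩL = ΩL} {ΩR} pre d y∉) =
    cut⊩ ΩL ΩR (map⊩ ⊆-refl &E₁ hyp⊩) (lookup pre (∈-insert ΩL)) y∉
         (sequent⇒natural d)
  sequent⇒natural (&L₂ {ΩL = ΩL} {ΩR} pre d y∉) =
    cut⊩ ΩL ΩR (map⊩ ⊆-refl &E₂ hyp⊩) (lookup pre (∈-insert ΩL)) y∉
         (sequent⇒natural d)
  sequent⇒natural (↑R pre d) =
    map⊩ ⊆-refl (λ d′ → ↑I d′ pre) (sequent⇒natural d)
  sequent⇒natural (↑L {ΩL = ΩL} {ΩR} _ d l≥r y∉) =
    cut⊩ ΩL ΩR (map⊩ ⊆-refl ↑E hyp⊩) l≥r y∉ (sequent⇒natural d)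
  sequent⇒natural (M← {ΩL = ΩL} {ΩM} {ΩR} _ d σm) =
    map⊩ (⊆-reflexive-↭ (↭-move ΩL ΩM _ ΩR))
         (λ d′ → M←ᴺ {ΩL = ΩL} {ΩM = ΩM} {ΩR = ΩR} d′ σm) (sequent⇒natural d)
  sequent⇒natural (M→ {ΩL = ΩL} {ΩM} {ΩR} _ d σm) =
    map⊩ (⊆-reflexive-↭ (↭-sym (↭-move ΩL ΩM _ ΩR)))
         (λ d′ → M→ᴺ {ΩL = ΩL} {ΩM = ΩM} {ΩR = ΩR} d′ σm) (sequent⇒natural d)
  sequent⇒natural (C← {ΩL = ΩL} {ΩM} {ΩR} _ d σm) =
    map⊩ (⊆-contractˡ ΩL ΩM _ ΩR)
         (λ d′ → C←ᴺ {ΩL = ΩL} {ΩM = ΩM} {ΩR = ΩR} d′ σm) (sequent⇒natural d)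
  sequent⇒natural (C→ {ΩL = ΩL} {ΩM} {ΩR} _ d σm) =
    map⊩ (⊆-contractʳ ΩL ΩM _ ΩR)
         (λ d′ → C→ᴺ {ΩL = ΩL} {ΩM = ΩM} {ΩR = ΩR} d′ σm) (sequent⇒natural d)
  sequent⇒natural (Wk {ΩL = ΩL} {ΩR} pre d σm) Γ s =
    Wᴺ {ΩL = ΩL} {ΩR = ΩR} (sequent⇒natural d Γ (s ∘ ⊆-insert ΩL _ ΩR))
       (s (∈-insert ΩL)) (lookup pre (∈-insert ΩL)) σm

theorem4 : ∀ {a ℓ} (S : ModeSystem a ℓ) → let open Calculus S in
    ∀ {r} {Ω : Ctx} {A : Prop r} →
    Ω ⊢ˢ A →
    (Γ : Ctx) → (∀ {h} → h ∈ Ω → h ∈ Γ) →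
    Γ ⊢ A ⊣ Ω
theorem4 S = Translation.sequent⇒natural S
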